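{- For every $n\ge 0$, the number of DI-sortable permutations of $[n+1]$ whose last entry is $1$ (equivalently, DI-sortable permutations of $[n+1]$ with exactly one right-to-left minimum) equals the Catalan number $C_n=\frac{1}{n+1}\binom{2n}{n}$.
   Context: A right-to-left minimum of $\pi$ is an entry $\pi_i$ with $\pi_i<\pi_j$ for all $j>i$. A permutation $\pi=\pi_1\cdots\pi_m$ of $[m]$ is processed by a machine consisting of an input (initially $\pi_1,\dots,\pi_m$), a first stack, a second stack, and an output, with operations: $\mathsf{E}$ moves the next input entry onto the top of the first stack; $\mathsf{N}$ pops the top of the first stack and pushes it onto the second stack; $\mathsf{C}$ pops the top of the second stack to the output. $\pi$ is DI-sortable if there is a word over $\{\mathsf{E},\mathsf{N},\mathsf{C}\}$ whose operations are all legal when applied in order starting from $\pi$ in the input and empty stacks, whose final output is $12\cdots m$, and during which the first stack's entries always decrease from top to bottom and the second stack's entries always increase from top to bottom. -}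

module Defs where

open import Data.Nat using (ℕ; zero; suc; _+_; _*_; _<_; _>_; _/_)
open import Data.Nat.Combinatorics using (_C_)
open import Data.List using (List; []; _∷_; _++_; [_]; map; upTo; last; length)
open import Data.List.Relation.Unary.Linked using (Linked)
open import Data.List.Relation.Binary.Permutation.Propositional using (_↭_)
open import Data.Maybe using (Maybe; just; nothing)
open import Data.Product using (_×_; ∃; ∃-syntax)
open import Relation.Binary.PropositionalEquality using (_≡_)

oneTo : ℕ → List ℕ
oneTo m = map suc (upTo m)

-- a permutation of [m] in one-line notation π₁ ⋯ πₘ
IsPerm : ℕ → List ℕ → Set
IsPerm m π = π ↭ oneTo m

data Op : Set where
  opE opN opC : Op

-- machine configuration: input, first stack (head = top),
-- second stack (head = top), output (in order written)
record Config : Set where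
  constructor config
  field
    input  : List ℕ
    stack1 : List ℕ
    stack2 : List ℕ
    output : List ℕ
open Config public

step : Op → Config → Maybe Config
step opE (config []       s₁ s₂ o) = nothing
step opE (config (x ∷ i)  s₁ s₂ o) = just (config i (x ∷ s₁) s₂ o)
step opN (config i []       s₂ o) = nothing
step opN (config i (x ∷ s₁) s₂ o) = just (config i s₁ (x ∷ s₂) o)
step opC (config i s₁ []       o) = nothing
step opC (config i s₁ (x ∷ s₂) o) = just (config i s₁ s₂ (o ++ [ x ]))

Good : Config → Set
Good c = Linked _>_ (stack1 c) × Linked _<_ (stack2 c)

data Valid : Config → List Op → Config → Set where
  done : ∀ {c} → Good c → Valid c [] c
  next : ∀ {c c′ d o w} → Good c → step o c ≡ just c′ → Valid c′ w d →
         Valid c (o ∷ w) d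

initial : List ℕ → Config
initial π = config π [] [] []

DISortable : List ℕ → Set
DISortable π = ∃[ w ] ∃[ d ] (Valid (initial π) w d × output d ≡ oneTo (length π))

catalan : ℕ → ℕ
catalan n = ((2 * n) C n) / suc n

module Submission where

-- Write π = r ++ [1] with r a permutation of 2, …, n+1.  Since the output must
-- begin with 1, nothing is written before 1 is read, and 1 can only be read
-- onto an empty first stack; so a sorting run first loads all of r with E and
-- N moves until the second stack holds exactly 2, …, n+1 (top first), then
-- moves 1 across and writes out the second stack (`read-1`,
-- `sorted⇒preimage`).  Conversely each such loading extends to a sorting run
-- (`preimage⇒sorted`).  The inputs r admitting such a loading are enumerated
-- by running the machine backwards (`preimages`): this list has no
-- repetitions, contains exactly the loadable inputs, and its length obeys the
-- ballot recursion.

open import Defs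
open import Data.Nat using (ℕ; suc)
open import Data.List using (List; length; last)
open import Data.List.Relation.Unary.Unique.Propositional using (Unique)
open import Data.List.Membership.Propositional using (_∈_)
open import Data.Maybe using (just)
open import Data.Product using (_×_; ∃-syntax)
open import Function.Bundles using (_⇔_)
open import Relation.Binary.PropositionalEquality using (_≡_)

open import Data.Nat using (zero; _+_; _*_; _∸_; _/_; _<_; _>_; _≤_)
open import Data.Nat.Properties
open import Data.Nat.Combinatorics using (_C_; nCk≡nC[n∸k]; nC1≡n; nCk+nC[k+1]≡[n+1]C[k+1])
open import Data.Nat.DivMod using (m*n/n≡m)
open import Data.Nat.Tactic.RingSolver using (solve-∀)
open import Data.List using ([]; _∷_; _++_; [_]; map; applyUpTo)
open import Data.List.Properties using (++-assoc; ++-identityʳ; ++-cancelʳ; ∷ʳ-injectiveʳ; ∷-injective; length-++; length-map)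
open import Data.List.Relation.Unary.All as All using (All; []; _∷_)
open import Data.List.Relation.Unary.Any using (here)
open import Data.List.Relation.Unary.Linked as Linked using (Linked; []; [-]; _∷_)
open import Data.List.Relation.Unary.AllPairs using ([]; _∷_)
import Data.List.Relation.Unary.Unique.Propositional.Properties as Unique
open import Data.List.Membership.Propositional.Properties using (∈-++⁺ˡ; ∈-++⁺ʳ; ∈-++⁻; ∈-map⁺; ∈-map⁻)
open import Data.List.Relation.Binary.Permutation.Propositional using (_↭_; ↭-refl; ↭-sym; ↭-trans; prep)
open import Data.List.Relation.Binary.Permutation.Propositional.Properties
  using (shift; ++⁺ˡ; drop-∷; ∷↭∷ʳ; All-resp-↭; ↭-length)
open import Data.Product using (_,_; proj₂)
open import Data.Sum using (_⊎_; inj₁; inj₂; [_,_]′)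
open import Data.Empty using (⊥-elim)
open import Function.Bundles using (mk⇔; Equivalence)
open import Relation.Nullary using (¬_)
open import Relation.Binary.PropositionalEquality using (refl; sym; trans; cong; cong₂; subst; module ≡-Reasoning)
open ≡-Reasoning

-- ballot k s: the number of ways to undo a run from a configuration in which
-- k values remain to be taken off the second stack and s entries sit on the
-- first stack (it counts the lists produced by `preimages` below).
ballot : ℕ → ℕ → ℕ
ballot zero    s       = 1
ballot (suc k) zero    = ballot k 1
ballot (suc k) (suc s) = ballot (suc k) s + ballot k (suc (suc s))

binomPred : ℕ → ℕ → ℕ
binomPred m zero    = 0
binomPred m (suc k) = m C k

pascal : ∀ m k → suc m C k ≡ binomPred m k + m C k
pascal m zero    = refl
pascal m (suc k) = sym (nCk+nC[k+1]≡[n+1]C[k+1] m k)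

C-symmetric : ∀ {n} a b → a + b ≡ n → n C a ≡ n C b
C-symmetric a b refl = begin
  (a + b) C a             ≡⟨ nCk≡nC[n∸k] (m≤m+n a b) ⟩
  (a + b) C (a + b ∸ a)   ≡⟨ cong ((a + b) C_) (m+n∸m≡n a b) ⟩
  (a + b) C b             ∎

middle-symmetric : ∀ k → suc (k + k) C suc k ≡ suc (k + k) C k
middle-symmetric k = C-symmetric (suc k) k refl

absorption : ∀ m k → suc k * (suc m C suc k) ≡ suc m * (m C k)
absorption zero    zero    = refl
absorption zero    (suc k) = *-zeroʳ (suc (suc k))
absorption (suc m) zero    = trans (*-identityˡ _) (trans (nC1≡n (suc (suc m))) (sym (*-identityʳ _)))
absorption (suc m) (suc k) = begin
  suc (suc k) * (suc M C suc (suc k))   ≡⟨ cong (suc (suc k) *_) (sym (nCk+nC[k+1]≡[n+1]C[k+1] M (suc k))) ⟩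
  suc (suc k) * (a + b)                 ≡⟨ regroup (suc k) a b ⟩
  a + (suc k * a + suc (suc k) * b)     ≡⟨ cong₂ (λ u v → a + (u + v)) (absorption m k) (absorption m (suc k)) ⟩
  a + (M * (m C k) + M * (m C suc k))   ≡⟨ cong (a +_) (sym (*-distribˡ-+ M (m C k) (m C suc k))) ⟩
  a + M * (m C k + m C suc k)           ≡⟨ cong (λ z → a + M * z) (nCk+nC[k+1]≡[n+1]C[k+1] m k) ⟩
  a + M * a                             ∎
  where
  M a b : ℕ
  M = suc m
  a = M C suc k
  b = M C suc (suc k)
  regroup : ∀ j x y → suc j * (x + y) ≡ x + (j * x + suc j * y)
  regroup = solve-∀

-- The number of moves still to be undone from a state counted by ballot k s.
width : ℕ → ℕ → ℕ
width k s = s + (k + k)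

width-suc : ∀ k s → width (suc k) s ≡ suc (width k (suc s))
width-suc = arithmetic
  where
  arithmetic : ∀ k s → s + (suc k + suc k) ≡ suc (suc s + (k + k))
  arithmetic = solve-∀

-- Reflection principle in closed form: ballot k s = C(w, k) - C(w, k - 1)
-- with w = s + 2k.  The two statements are proved by simultaneous induction;
-- `ballot-step` is the case k + 1 with the width written as suc (width k (s+1)).
ballot-formula : ∀ k s → ballot k s + binomPred (width k s) k ≡ width k s C k
ballot-step    : ∀ k s → ballot (suc k) s + suc (width k (suc s)) C k ≡ suc (width k (suc s)) C suc k

ballot-formula zero    s = refl
ballot-formula (suc k) s =
  subst (λ m → ballot (suc k) s + binomPred m (suc k) ≡ m C suc k) (sym (width-suc k s)) (ballot-step k s)

ballot-step k zero = begin
  ballot k 1 + suc M C k                   ≡⟨ cong (ballot k 1 +_) (pascal M k) ⟩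
  ballot k 1 + (binomPred M k + M C k)     ≡⟨ sym (+-assoc (ballot k 1) _ _) ⟩
  (ballot k 1 + binomPred M k) + M C k     ≡⟨ cong (_+ M C k) (ballot-formula k 1) ⟩
  M C k + M C k                            ≡⟨ cong (M C k +_) (middle-symmetric k) ⟨
  M C k + M C suc k                        ≡⟨ nCk+nC[k+1]≡[n+1]C[k+1] M k ⟩
  suc M C suc k                            ∎
  where
  M : ℕ
  M = width k 1
ballot-step k (suc s) = begin
  (x + y) + suc M C k                      ≡⟨ cong ((x + y) +_) (pascal M k) ⟩
  (x + y) + (binomPred M k + M C k)        ≡⟨ interchange x y (binomPred M k) (M C k) ⟩
  (x + M C k) + (y + binomPred M k)        ≡⟨ cong₂ _+_ (ballot-step k s) (ballot-formula k (suc (suc s))) ⟩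
  M C suc k + M C k                        ≡⟨ +-comm (M C suc k) (M C k) ⟩
  M C k + M C suc k                        ≡⟨ nCk+nC[k+1]≡[n+1]C[k+1] M k ⟩
  suc M C suc k                            ∎
  where
  M x y : ℕ
  M = width k (suc (suc s))
  x = ballot (suc k) s
  y = ballot k (suc (suc s))
  interchange : ∀ a b c d → (a + b) + (c + d) ≡ (a + d) + (b + c)
  interchange = solve-∀

central-absorption : ∀ n → suc n * binomPred (n + n) n ≡ n * ((n + n) C n)
central-absorption zero    = refl
central-absorption (suc k) = begin
  suc (suc k) * (D C k)               ≡⟨ cong (suc (suc k) *_) (C-symmetric k (suc (suc k)) (+-suc k (suc k))) ⟩
  suc (suc k) * (D C suc (suc k))     ≡⟨ absorption (k + suc k) (suc k) ⟩
  D * ((k + suc k) C suc k)           ≡⟨ cong (D *_) (C-symmetric (suc k) k (sym (+-suc k k))) ⟩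
  D * ((k + suc k) C k)               ≡⟨ absorption (k + suc k) k ⟨
  suc k * (D C suc k)                 ∎
  where
  D : ℕ
  D = suc k + suc k

ballot-catalan : ∀ n → ballot n 0 ≡ catalan n
ballot-catalan n = begin
  c                         ≡⟨ m*n/n≡m c (suc n) ⟨
  c * suc n / suc n         ≡⟨ cong (_/ suc n) times-suc ⟩
  B / suc n                 ≡⟨ cong (λ m → ((n + m) C n) / suc n) (+-identityʳ n) ⟨
  catalan n                 ∎
  where
  B c : ℕ
  B = (n + n) C n
  c = ballot n 0
  scaled : suc n * c + n * B ≡ B + n * B
  scaled = begin
    suc n * c + n * B                               ≡⟨ cong (suc n * c +_) (central-absorption n) ⟨
    suc n * c + suc n * binomPred (n + n) n         ≡⟨ *-distribˡ-+ (suc n) c _ ⟨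
    suc n * (c + binomPred (n + n) n)               ≡⟨ cong (suc n *_) (ballot-formula n 0) ⟩
    suc n * B                                       ∎
  times-suc : c * suc n ≡ B
  times-suc = trans (*-comm c (suc n)) (+-cancelʳ-≡ (n * B) (suc n * c) B scaled)

Valid-++ : ∀ {c w m w′ d} → Valid c w m → Valid m w′ d → Valid c (w ++ w′) d
Valid-++ (done _)     V′ = V′
Valid-++ (next g e V) V′ = next g e (Valid-++ V V′)

Valid-good : ∀ {c w d} → Valid c w d → Good c
Valid-good (done g)     = g
Valid-good (next g _ _) = g

Valid-good-end : ∀ {c w d} → Valid c w d → Good d
Valid-good-end (done g)     = g
Valid-good-end (next _ _ V) = Valid-good-end V

step-output : ∀ o c {c′} → step o c ≡ just c′ → ∃[ z ] output c′ ≡ output c ++ z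
step-output opE (config (x ∷ i) s₁ s₂ ou) refl = [] , sym (++-identityʳ ou)
step-output opN (config i (x ∷ s₁) s₂ ou) refl = [] , sym (++-identityʳ ou)
step-output opC (config i s₁ (x ∷ s₂) ou) refl = [ x ] , refl

output-grows : ∀ {c w d} → Valid c w d → ∃[ z ] output d ≡ output c ++ z
output-grows {c} (done _) = [] , sym (++-identityʳ (output c))
output-grows {c} (next {o = o} _ e V) with step-output o c e | output-grows V
... | z₁ , e₁ | z₂ , e₂ = z₁ ++ z₂ , trans e₂ (trans (cong (_++ z₂) e₁) (++-assoc (output c) z₁ z₂))

-- With input and first stack empty only C applies, so the output gains a
-- prefix of the second stack.
drain-prefix : ∀ {U ou w d} → Valid (config [] [] U ou) w d →
               ∃[ U₁ ] ∃[ U₂ ] (U ≡ U₁ ++ U₂ × output d ≡ ou ++ U₁)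
drain-prefix {U} {ou} (done _) = [] , U , refl , sym (++-identityʳ ou)
drain-prefix {x ∷ U} {ou} (next {o = opC} _ refl V) with drain-prefix V
... | U₁ , U₂ , e₁ , e₂ = x ∷ U₁ , U₂ , cong (x ∷_) e₁ , trans e₂ (++-assoc ou [ x ] U₁)

drain : ∀ T ou → Linked _<_ T → ∃[ w ] ∃[ d ] (Valid (config [] [] T ou) w d × output d ≡ ou ++ T)
drain []      ou _ = [] , _ , done ([] , []) , sym (++-identityʳ ou)
drain (x ∷ T) ou l with drain T (ou ++ [ x ]) (Linked.tail l)
... | w , d , V , e = opC ∷ w , d , next ([] , l) refl V , trans e (++-assoc ou [ x ] T)

Valid-snoc : ∀ {c w m d} o → Valid c w m → step o m ≡ just d → Good d → Valid c (w ++ [ o ]) d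
Valid-snoc o V e gd = Valid-++ V (next (Valid-good-end V) e (done gd))

extend-E : ∀ {c x i S T} → Linked _>_ (x ∷ S) → Linked _<_ T →
           ∃[ w ] Valid c w (config (x ∷ i) S T []) → ∃[ w ] Valid c w (config i (x ∷ S) T [])
extend-E dec inc (w , V) = w ++ [ opE ] , Valid-snoc opE V refl (dec , inc)

extend-N : ∀ {c i x S T} → Linked _>_ S → Linked _<_ (x ∷ T) →
           ∃[ w ] Valid c w (config i (x ∷ S) T []) → ∃[ w ] Valid c w (config i S (x ∷ T) [])
extend-N dec inc (w , V) = w ++ [ opN ] , Valid-snoc opN V refl (dec , inc)

interval : ℕ → ℕ → List ℕ
interval a zero    = []
interval a (suc k) = a ∷ interval (suc a) k

interval-length : ∀ a k → length (interval a k) ≡ k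
interval-length a zero    = refl
interval-length a (suc k) = cong suc (interval-length (suc a) k)

interval-increasing : ∀ a k → Linked _<_ (interval a k)
interval-increasing a zero          = []
interval-increasing a (suc zero)    = [-]
interval-increasing a (suc (suc k)) = ≤-refl ∷ interval-increasing (suc a) (suc k)

interval-bounded : ∀ a k → All (a ≤_) (interval a k)
interval-bounded a zero    = []
interval-bounded a (suc k) = ≤-refl ∷ All.map (≤-trans (n≤1+n a)) (interval-bounded (suc a) k)

-- Backward enumeration.  preimages a k S acc undoes a loading phase (E and N
-- moves only) that ends with input acc, first stack S and second stack
-- interval a k: undoing N moves a back onto the first stack, undoing E moves
-- the top of the first stack back to the front of the input.  It lists the
-- possible initial inputs.
preimages : ℕ → ℕ → List ℕ → List ℕ → List (List ℕ)
preimages a zero    []      acc = [ acc ]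
preimages a zero    (x ∷ S) acc = preimages a zero S (x ∷ acc)
preimages a (suc k) []      acc = preimages (suc a) k [ a ] acc
preimages a (suc k) (x ∷ S) acc = preimages a (suc k) S (x ∷ acc) ++ preimages (suc a) k (a ∷ x ∷ S) acc

preimages-length : ∀ a k S acc → length (preimages a k S acc) ≡ ballot k (length S)
preimages-length a zero    []      acc = refl
preimages-length a zero    (x ∷ S) acc = preimages-length a zero S (x ∷ acc)
preimages-length a (suc k) []      acc = preimages-length (suc a) k [ a ] acc
preimages-length a (suc k) (x ∷ S) acc =
  trans (length-++ (preimages a (suc k) S (x ∷ acc)))
        (cong₂ _+_ (preimages-length a (suc k) S (x ∷ acc)) (preimages-length (suc a) k (a ∷ x ∷ S) acc))

push-back : ∀ {r x} {acc : List ℕ} → (∃[ Y ] r ≡ Y ++ x ∷ acc) → ∃[ Y ] r ≡ Y ++ acc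
push-back {x = x} {acc} (Y , e) = Y ++ [ x ] , trans e (sym (++-assoc Y [ x ] acc))

preimages-suffix : ∀ a k S acc r → r ∈ preimages a k S acc → ∃[ Y ] r ≡ Y ++ acc
preimages-suffix a zero    []      acc r (here e) = [] , e
preimages-suffix a zero    (x ∷ S) acc r p = push-back (preimages-suffix a zero S (x ∷ acc) r p)
preimages-suffix a (suc k) []      acc r p = preimages-suffix (suc a) k [ a ] acc r p
preimages-suffix a (suc k) (x ∷ S) acc r p =
  [ (λ p₁ → push-back (preimages-suffix a (suc k) S (x ∷ acc) r p₁))
  , preimages-suffix (suc a) k (a ∷ x ∷ S) acc r ]′ (∈-++⁻ (preimages a (suc k) S (x ∷ acc)) p)

preimages-entry : ∀ a k z S acc r → r ∈ preimages a k (z ∷ S) acc →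
                  ∃[ Y ] ∃[ v ] (r ≡ Y ++ v ∷ acc × (v ≡ z ⊎ a ≤ v))
preimages-entry a zero z S acc r p with preimages-suffix a zero S (z ∷ acc) r p
... | Y , e = Y , z , e , inj₁ refl
preimages-entry a (suc k) z S acc r p with ∈-++⁻ (preimages a (suc k) S (z ∷ acc)) p
... | inj₁ p₁ with preimages-suffix a (suc k) S (z ∷ acc) r p₁
...   | Y , e = Y , z , e , inj₁ refl
preimages-entry a (suc k) z S acc r p | inj₂ p₂ with preimages-entry (suc a) k a (z ∷ S) acc r p₂
... | Y , v , e , inj₁ v≡a  = Y , v , e , inj₂ (≤-reflexive (sym v≡a))
... | Y , v , e , inj₂ a<v = Y , v , e , inj₂ (≤-trans (n≤1+n a) a<v)

entry-before-suffix : ∀ Y₁ Y₂ x v (acc : List ℕ) → Y₁ ++ x ∷ acc ≡ Y₂ ++ v ∷ acc → x ≡ v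
entry-before-suffix Y₁ Y₂ x v acc e = ∷ʳ-injectiveʳ Y₁ Y₂ (++-cancelʳ acc (Y₁ ++ [ x ]) (Y₂ ++ [ v ])
  (trans (++-assoc Y₁ [ x ] acc) (trans e (sym (++-assoc Y₂ [ v ] acc)))))

-- The enumeration has no repetitions: the two branches of the last clause
-- differ in the entry placed just before acc (x, versus something > x).
preimages-unique : ∀ a k S acc → All (_< a) S → Unique (preimages a k S acc)
preimages-unique a zero    []      acc _          = [] ∷ []
preimages-unique a zero    (x ∷ S) acc (_ ∷ S<a)  = preimages-unique a zero S (x ∷ acc) S<a
preimages-unique a (suc k) []      acc _          = preimages-unique (suc a) k [ a ] acc (≤-refl ∷ [])
preimages-unique a (suc k) (x ∷ S) acc xS<a@(x<a ∷ S<a) =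
  Unique.++⁺ (preimages-unique a (suc k) S (x ∷ acc) S<a)
             (preimages-unique (suc a) k (a ∷ x ∷ S) acc (≤-refl ∷ All.map m<n⇒m<1+n xS<a))
             disjoint
  where
  disjoint : ∀ {r} → ¬ (r ∈ preimages a (suc k) S (x ∷ acc) × r ∈ preimages (suc a) k (a ∷ x ∷ S) acc)
  disjoint {r} (p₁ , p₂) with preimages-suffix a (suc k) S (x ∷ acc) r p₁
                            | preimages-entry (suc a) k a (x ∷ S) acc r p₂
  ... | Y₁ , e₁ | Y₂ , v , e₂ , v-large with entry-before-suffix Y₁ Y₂ x v acc (trans (sym e₁) e₂)
  ... | refl with v-large
  ...   | inj₁ refl = <-irrefl refl x<a
  ...   | inj₂ a<v  = <-irrefl refl (<-≤-trans x<a (≤-trans (n≤1+n a) a<v))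

preimages-↭ : ∀ a k S acc r → r ∈ preimages a k S acc → r ↭ interval a k ++ S ++ acc
preimages-↭ a zero    []      acc r (here refl) = ↭-refl
preimages-↭ a zero    (x ∷ S) acc r p = ↭-trans (preimages-↭ a zero S (x ∷ acc) r p) (shift x S acc)
preimages-↭ a (suc k) []      acc r p =
  ↭-trans (preimages-↭ (suc a) k [ a ] acc r p) (shift a (interval (suc a) k) acc)
preimages-↭ a (suc k) (x ∷ S) acc r p =
  [ (λ p₁ → ↭-trans (preimages-↭ a (suc k) S (x ∷ acc) r p₁) (++⁺ˡ (interval a (suc k)) (shift x S acc)))
  , (λ p₂ → ↭-trans (preimages-↭ (suc a) k (a ∷ x ∷ S) acc r p₂) (shift a (interval (suc a) k) (x ∷ S ++ acc))) ]′
  (∈-++⁻ (preimages a (suc k) S (x ∷ acc)) p)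

preimages-run : ∀ a k S acc t r → r ∈ preimages a k S acc → Linked _>_ S → All (_< a) S →
                ∃[ w ] Valid (initial (r ++ t)) w (config (acc ++ t) S (interval a k) [])
preimages-run a zero    []      acc t r (here refl) _ _ = [] , done ([] , [])
preimages-run a zero    (x ∷ S) acc t r p dec (_ ∷ S<a) =
  extend-E dec [] (preimages-run a zero S (x ∷ acc) t r p (Linked.tail dec) S<a)
preimages-run a (suc k) []      acc t r p _ _ =
  extend-N [] (interval-increasing a (suc k)) (preimages-run (suc a) k [ a ] acc t r p [-] (≤-refl ∷ []))
preimages-run a (suc k) (x ∷ S) acc t r p dec xS<a@(x<a ∷ S<a) =
  [ (λ p₁ → extend-E dec (interval-increasing a (suc k))
             (preimages-run a (suc k) S (x ∷ acc) t r p₁ (Linked.tail dec) S<a))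
  , (λ p₂ → extend-N dec (interval-increasing a (suc k))
             (preimages-run (suc a) k (a ∷ x ∷ S) acc t r p₂ (x<a ∷ dec) (≤-refl ∷ All.map m<n⇒m<1+n xS<a))) ]′
  (∈-++⁻ (preimages a (suc k) S (x ∷ acc)) p)

data Loading (r : List ℕ) : List ℕ → List ℕ → List ℕ → Set where
  start  : Loading r r [] []
  load-E : ∀ {x i S T} → Loading r (x ∷ i) S T → Loading r i (x ∷ S) T
  load-N : ∀ {y i S T} → Loading r i (y ∷ S) T → Loading r i S (y ∷ T)

loading-length : ∀ {r i S T} → Loading r i S T → length r ≡ length T + (length S + length i)
loading-length start = refl
loading-length {i = i} {x ∷ S} {T} (load-E L) = trans (loading-length L) (cong (length T +_) (+-suc (length S) (length i)))
loading-length (load-N L) = trans (loading-length L) (+-suc _ _)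

loading⇒preimage : ∀ {r i S T} a k → Loading r i S T → T ≡ interval a k → All (_< a) S →
                   r ∈ preimages a k S i
loading⇒preimage a zero    start      refl _          = here refl
loading⇒preimage a zero    (load-E L) refl (_ ∷ S<a)  = loading⇒preimage a zero L refl S<a
loading⇒preimage a (suc k) (load-E L) refl (_ ∷ S<a)  = ∈-++⁺ˡ (loading⇒preimage a (suc k) L refl S<a)
loading⇒preimage {S = []}    a (suc k) (load-N L) refl _ = loading⇒preimage (suc a) k L refl (≤-refl ∷ [])
loading⇒preimage {i = i} {S = x ∷ S} a (suc k) (load-N L) refl S<a =
  ∈-++⁺ʳ (preimages a (suc k) S (x ∷ i)) (loading⇒preimage (suc a) k L refl (≤-refl ∷ All.map m<n⇒m<1+n S<a))

wrong-first-output : ∀ {i S T x w d R} → 1 < x → Valid (config i S T [ x ]) w d → ¬ output d ≡ 1 ∷ R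
wrong-first-output 1<x V e with output-grows V
... | z , e′ with trans (sym e′) e
...   | refl = <-irrefl refl 1<x

-- Once 1 has been pushed onto the (necessarily empty) first stack, the next
-- move of a run producing 1 2 ⋯ must carry it to the second stack.
after-reading-1 : ∀ {T w d R} → All (1 <_) T → Valid (config [] [ 1 ] T []) w d → output d ≡ 1 ∷ R →
                  ∃[ w′ ] Valid (config [] [] (1 ∷ T) []) w′ d
after-reading-1 _          (done _)                       ()
after-reading-1 _          (next {o = opN} _ refl V)      _ = _ , V
after-reading-1 (1<x ∷ _)  (next {o = opC} _ refl V)      e = ⊥-elim (wrong-first-output 1<x V e)

-- In a run of r ++ [1] producing 1 2 ⋯, nothing is written before 1 is read
-- (the second stack holds entries > 1), and 1 can only be read onto an empty
-- first stack; so the run starts with a loading of all of r followed by E N.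
read-1 : ∀ {r i S T w d R} → Loading r i S T → All (1 <_) i → All (1 <_) S → All (1 <_) T →
         Valid (config (i ++ [ 1 ]) S T []) w d → output d ≡ 1 ∷ R →
         ∃[ T′ ] ∃[ w′ ] (Loading r [] [] T′ × Valid (config [] [] (1 ∷ T′) []) w′ d)
read-1 L _ _ _ (done _) ()
read-1 {i = x ∷ i} L (1<x ∷ 1<i) 1<S 1<T (next {o = opE} _ refl V) e = read-1 (load-E L) 1<i (1<x ∷ 1<S) 1<T V e
read-1 {i = []} {S = x ∷ S} L _ (1<x ∷ _) _ (next {o = opE} _ refl V) _ with Valid-good V
... | (1>x ∷ _ , _) = ⊥-elim (<-asym 1<x 1>x)
read-1 {i = []} {S = []} {T} L _ _ 1<T (next {o = opE} _ refl V) e with after-reading-1 1<T V e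
... | w′ , V′ = T , w′ , L , V′
read-1 {S = y ∷ S} L 1<i (1<y ∷ 1<S) 1<T (next {o = opN} _ refl V) e = read-1 (load-N L) 1<i 1<S (1<y ∷ 1<T) V e
read-1 {T = x ∷ T} L _ _ (1<x ∷ _) (next {o = opC} _ refl V) e = ⊥-elim (wrong-first-output 1<x V e)

no-room-after : ∀ (xs ys : List ℕ) → length (xs ++ ys) ≡ length xs → ys ≡ []
no-room-after xs []       _ = refl
no-room-after xs (y ∷ ys) e = ⊥-elim (m+1+n≢m (length xs) (trans (sym (length-++ xs)) e))

-- Sortable inputs r ++ [1] come from the enumeration: the run loads r, then
-- reads 1 and passes it on, and finally only writes out the second stack,
-- which must therefore already hold 2, …, n+1.
sorted⇒preimage : ∀ n r {w d} → r ↭ interval 2 n → Valid (initial (r ++ [ 1 ])) w d →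
                  output d ≡ interval 1 (suc n) → r ∈ preimages 2 n [] []
sorted⇒preimage n r r↭ V out
  with read-1 start (All-resp-↭ (↭-sym r↭) (interval-bounded 2 n)) [] [] V out
... | T , w′ , L , V′ with drain-prefix V′
...   | U₁ , U₂ , split , written with trans (sym written) out
...     | refl = loading⇒preimage 2 n L T-interval []
  where
  T≡ : T ≡ interval 2 n ++ U₂
  T≡ = proj₂ (∷-injective split)
  T-length : length (interval 2 n ++ U₂) ≡ length (interval 2 n)
  T-length = begin
    length (interval 2 n ++ U₂)   ≡⟨ cong length T≡ ⟨
    length T                      ≡⟨ trans (sym (+-identityʳ (length T))) (sym (loading-length L)) ⟩
    length r                      ≡⟨ ↭-length r↭ ⟩
    length (interval 2 n)         ∎
  T-interval : T ≡ interval 2 n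
  T-interval = begin
    T                       ≡⟨ T≡ ⟩
    interval 2 n ++ U₂      ≡⟨ cong (interval 2 n ++_) (no-room-after (interval 2 n) U₂ T-length) ⟩
    interval 2 n ++ []      ≡⟨ ++-identityʳ (interval 2 n) ⟩
    interval 2 n            ∎

-- Conversely every enumerated r gives a sorting run of r ++ [1]: load r,
-- read 1 and pass it on, then write out 1, 2, …, n+1.
preimage⇒sorted : ∀ n r → r ∈ preimages 2 n [] [] →
                  ∃[ w ] ∃[ d ] (Valid (initial (r ++ [ 1 ])) w d × output d ≡ interval 1 (suc n))
preimage⇒sorted n r p
  with preimages-run 2 n [] [] [ 1 ] r p [] [] | drain (interval 1 (suc n)) [] (interval-increasing 1 (suc n))
... | w₁ , V₁ | w₂ , d , V₂ , out =
  w₁ ++ opE ∷ opN ∷ w₂ , d ,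
  Valid-++ V₁ (next ([] , interval-increasing 2 n) refl (next ([-] , interval-increasing 2 n) refl V₂)) ,
  out

oneTo-interval : ∀ m → oneTo m ≡ interval 1 m
oneTo-interval m = shifted m 0 (λ i → i) (λ i → refl)
  where
  shifted : ∀ m a (f : ℕ → ℕ) → (∀ i → f i ≡ a + i) → map suc (applyUpTo f m) ≡ interval (suc a) m
  shifted zero    a f f≡ = refl
  shifted (suc m) a f f≡ = cong₂ _∷_ (cong suc (trans (f≡ 0) (+-identityʳ a)))
                                     (shifted m (suc a) (λ i → f (suc i)) (λ i → trans (f≡ (suc i)) (+-suc a i)))

perm-snoc-1 : ∀ n r → IsPerm (suc n) (r ++ [ 1 ]) ⇔ (r ↭ interval 2 n)
perm-snoc-1 n r = mk⇔
  (λ π↭ → drop-∷ (↭-trans (∷↭∷ʳ 1 r) (subst ((r ++ [ 1 ]) ↭_) (oneTo-interval (suc n)) π↭)))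
  (λ r↭ → subst ((r ++ [ 1 ]) ↭_) (sym (oneTo-interval (suc n))) (↭-trans (↭-sym (∷↭∷ʳ 1 r)) (prep 1 r↭)))

snoc-1-length : ∀ n r → r ↭ interval 2 n → length (r ++ [ 1 ]) ≡ suc n
snoc-1-length n r r↭ = begin
  length (r ++ [ 1 ])   ≡⟨ length-++ r ⟩
  length r + 1          ≡⟨ +-comm (length r) 1 ⟩
  suc (length r)        ≡⟨ cong suc (trans (↭-length r↭) (interval-length 2 n)) ⟩
  suc n                 ∎

preimage-permutes : ∀ n r → r ∈ preimages 2 n [] [] → r ↭ interval 2 n
preimage-permutes n r p = subst (r ↭_) (++-identityʳ (interval 2 n)) (preimages-↭ 2 n [] [] r p)

sortable⇔preimage : ∀ n r → r ↭ interval 2 n → DISortable (r ++ [ 1 ]) ⇔ (r ∈ preimages 2 n [] [])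
sortable⇔preimage n r r↭ = mk⇔
  (λ { (w , d , V , out) → sorted⇒preimage n r r↭ V (trans out target) })
  (λ p → let (w , d , V , out) = preimage⇒sorted n r p in w , d , V , trans out (sym target))
  where
  target : oneTo (length (r ++ [ 1 ])) ≡ interval 1 (suc n)
  target = trans (cong oneTo (snoc-1-length n r r↭)) (oneTo-interval (suc n))

last-snoc : ∀ (r : List ℕ) x → last (r ++ [ x ]) ≡ just x
last-snoc []          x = refl
last-snoc (y ∷ [])    x = refl
last-snoc (y ∷ z ∷ r) x = last-snoc (z ∷ r) x

last⇒snoc : ∀ (π : List ℕ) x → last π ≡ just x → ∃[ r ] π ≡ r ++ [ x ]
last⇒snoc (y ∷ [])    x refl = [] , refl
last⇒snoc (y ∷ z ∷ π) x e with last⇒snoc (z ∷ π) x e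
... | r , eq = y ∷ r , cong (y ∷_) eq

corollary4p4 : ∀ (n : ℕ) → ∃[ L ] (Unique L
    × (∀ (π : List ℕ) → (π ∈ L ⇔ (IsPerm (suc n) π × last π ≡ just 1 × DISortable π)))
    × length L ≡ catalan n)
corollary4p4 n = map (_++ [ 1 ]) E , unique , (λ π → mk⇔ (listed⇒ π) (⇒listed π)) , counted
  where
  E : List (List ℕ)
  E = preimages 2 n [] []
  unique : Unique (map (_++ [ 1 ]) E)
  unique = Unique.map⁺ (λ {r} {r′} → ++-cancelʳ [ 1 ] r r′) (preimages-unique 2 n [] [] [])
  counted : length (map (_++ [ 1 ]) E) ≡ catalan n
  counted = trans (length-map (_++ [ 1 ]) E) (trans (preimages-length 2 n [] []) (ballot-catalan n))
  listed⇒ : ∀ π → π ∈ map (_++ [ 1 ]) E → IsPerm (suc n) π × last π ≡ just 1 × DISortable π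
  listed⇒ π q with ∈-map⁻ (_++ [ 1 ]) q
  ... | r , p , refl = Equivalence.from (perm-snoc-1 n r) r↭ , last-snoc r 1 ,
                       Equivalence.from (sortable⇔preimage n r r↭) p
    where
    r↭ : r ↭ interval 2 n
    r↭ = preimage-permutes n r p
  ⇒listed : ∀ π → IsPerm (suc n) π × last π ≡ just 1 × DISortable π → π ∈ map (_++ [ 1 ]) E
  ⇒listed π (π↭ , ends-in-1 , sortable) with last⇒snoc π 1 ends-in-1
  ... | r , refl = ∈-map⁺ (_++ [ 1 ]) (Equivalence.to (sortable⇔preimage n r r↭) sortable)
    where
    r↭ : r ↭ interval 2 n
    r↭ = Equivalence.to (perm-snoc-1 n r) π↭
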